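{- For every continuation $K$ and all terms $M, M'$, if $M\to_{l\cup\beta}M'$ then $\underline{K}[M]\to_{l\cup\beta}\underline{K}[M']$.
   Context: Syntax. Fix a ring of scalars; $\alpha,\beta$ range over it. Terms: $M,N,L ::= V \mid MN \mid \alpha.M \mid M+N$; values $V,W ::= B \mid 0 \mid \alpha.V \mid V+W$; base values $B ::= x \mid \lambda x.M$. Terms are taken up to $\alpha$-conversion, $M[x:=N]$ is capture-avoiding substitution. Rewrite rules. $(\beta_v)$: $(\lambda x.M)B \to M[x:=B]$, $B$ a base value. $(\xi_{\lambda_{lin}})$: if $M\to M'$ then $VM \to VM'$, $V$ a value. $(A_l)$: $(M+N)V \to MV+NV$; $(\alpha.M)V \to \alpha.(MV)$; $(0)V \to 0$, $V$ a value. $(A_r)$: $B(M+N)\to BM+BN$; $B(\alpha.M)\to \alpha.(BM)$; $B(0)\to 0$, $B$ a base value. $(L)$: $M+(N+L)\to(M+N)+L$; $(M+N)+L\to M+(N+L)$; $M+N\to N+M$; $\alpha.M+\beta.M\to(\alpha+\beta).M$; $\alpha.M+M\to(\alpha+1).M$; $M+M\to(1+1).M$; $\alpha.(\beta.M)\to(\alpha\beta).M$; $\alpha.(M+N)\to\alpha.M+\alpha.N$; $1.M\to M$; $0.M\to 0$; $\alpha.0\to 0$; $0+M\to M$. $(\xi)$: if $M\to M'$ then $MN\to M'N$, $M+N\to M'+N$, $N+M\to N+M'$, $\alpha.M\to\alpha.M'$. A union of rules denotes the generated relation, context rules applying to the relation being defined: $\to_{\beta_v} ::= \beta_v\cup\xi\cup\xi_{\lambda_{lin}}$;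 $\to_l ::= A_l\cup A_r\cup L\cup\xi\cup\xi_{\lambda_{lin}}$; $\to_{l\cup\beta} ::= \to_l\cup\to_{\beta_v}$. CPS grammar. Base computations $C ::= KB \mid B_1B_2K \mid TK$; base suspensions $S ::= \lambda k.C$; suspension combinations $T ::= S \mid 0\mid \alpha.T \mid T_1+T_2$; continuations $K ::= k \mid \lambda b.BbK \mid \lambda b_1.T(\lambda b_2.b_1b_2K)$; CPS-values $B ::= x \mid \lambda x.S$; computation combinations $D ::= C \mid 0 \mid \alpha.D \mid D_1+D_2$. Here $k,b,b_1,b_2$ are reserved variables distinct from ordinary variables $x$; $k$ occurs only as the continuation $k$ and as the binder in $\lambda k.C$; $b,b_1,b_2$ occur only where displayed. Inverse translation: $\overline{KB}=\underline{K}[\psi(B)]$; $\overline{B_1B_2K}=\underline{K}[\psi(B_1)\psi(B_2)]$; $\overline{TK}=\underline{K}[\sigma(T)]$; $\overline{0}=0$; $\overline{\alpha.D}=\alpha.\overline{D}$; $\overline{D_1+D_2}=\overline{D_1}+\overline{D_2}$; $\sigma(\lambda k.C)=\overline{C}$; $\sigma(0)=0$; $\sigma(\alpha.T)=\alpha.\sigma(T)$; $\sigma(T_1+T_2)=\sigma(T_1)+\sigma(T_2)$; $\psi(x)=x$; $\psi(\lambda x.S)=\lambda x.\sigma(S)$; for a term $M$: $\underline{k}[M]=M$; $\underline{\lambda b.BbK}[M]=\underline{K}[\psi(B)M]$; $\underline{\lambda b_1.T(\lambda b_2.b_1b_2K)}[M]=\underline{K}[M\,\sigma(T)]$. -}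

module Defs where

open import Level using (Level)
open import Data.Nat using (ℕ; zero; suc)
open import Data.Fin using (Fin; zero; suc)
open import Data.Sum using (_⊎_)
open import Algebra.Bundles using (Ring)

-- Terms are intrinsically scoped de Bruijn terms (this realises
-- "terms up to α-conversion"); Term n = terms with ≤ n free variables.
module Calculus {c ℓ : Level} (R : Ring c ℓ) where

  open Ring R using (Carrier; 0#; 1#) renaming (_+_ to _+ₛ_; _*_ to _*ₛ_)

  infixl 7 _·_
  infixl 6 _⊕_

  data Term (n : ℕ) : Set c where
    var  : Fin n → Term n
    lam  : Term (suc n) → Term n
    _·_  : Term n → Term n → Term n
    zer  : Term n
    _∙_  : Carrier → Term n → Term n
    _⊕_  : Term n → Term n → Term n

  data IsBase {n : ℕ} : Term n → Set c where
    var : (i : Fin n) → IsBase (var i)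
    lam : (M : Term (suc n)) → IsBase (lam M)

  data IsValue {n : ℕ} : Term n → Set c where
    base : {B : Term n} → IsBase B → IsValue B
    zer  : IsValue zer
    smul : (α : Carrier) {V : Term n} → IsValue V → IsValue (α ∙ V)
    add  : {V W : Term n} → IsValue V → IsValue W → IsValue (V ⊕ W)

  ext : {n m : ℕ} → (Fin n → Fin m) → Fin (suc n) → Fin (suc m)
  ext ρ zero    = zero
  ext ρ (suc i) = suc (ρ i)

  rename : {n m : ℕ} → (Fin n → Fin m) → Term n → Term m
  rename ρ (var i)  = var (ρ i)
  rename ρ (lam M)  = lam (rename (ext ρ) M)
  rename ρ (M · N)  = rename ρ M · rename ρ N
  rename ρ zer      = zer
  rename ρ (α ∙ M)  = α ∙ rename ρ M
  rename ρ (M ⊕ N)  = rename ρ M ⊕ rename ρ N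

  exts : {n m : ℕ} → (Fin n → Term m) → Fin (suc n) → Term (suc m)
  exts s zero    = var zero
  exts s (suc i) = rename suc (s i)

  subst : {n m : ℕ} → (Fin n → Term m) → Term n → Term m
  subst s (var i)  = s i
  subst s (lam M)  = lam (subst (exts s) M)
  subst s (M · N)  = subst s M · subst s N
  subst s zer      = zer
  subst s (α ∙ M)  = α ∙ subst s M
  subst s (M ⊕ N)  = subst s M ⊕ subst s N

  _[_] : {n : ℕ} → Term (suc n) → Term n → Term n
  M [ N ] = subst σ M
    where
      σ : Fin (suc _) → Term _
      σ zero    = N
      σ (suc i) = var i

  infix 4 _⟶β_ _⟶l_ _⟶lβ_

  data _⟶β_ {n : ℕ} : Term n → Term n → Set c where
    βv      : (M : Term (suc n)) {B : Term n} → IsBase B → lam M · B ⟶β M [ B ]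
    ξλlin   : {V M M' : Term n} → IsValue V → M ⟶β M' → V · M ⟶β V · M'
    ξappl   : {M M' N : Term n} → M ⟶β M' → M · N ⟶β M' · N
    ξaddl   : {M M' N : Term n} → M ⟶β M' → M ⊕ N ⟶β M' ⊕ N
    ξaddr   : {M M' N : Term n} → M ⟶β M' → N ⊕ M ⟶β N ⊕ M'
    ξsmul   : (α : Carrier) {M M' : Term n} → M ⟶β M' → α ∙ M ⟶β α ∙ M'

  data _⟶l_ {n : ℕ} : Term n → Term n → Set c where
    Al-add  : {M N V : Term n} → IsValue V → (M ⊕ N) · V ⟶l M · V ⊕ N · V
    Al-smul : (α : Carrier) {M V : Term n} → IsValue V → (α ∙ M) · V ⟶l α ∙ (M · V)
    Al-zer  : {V : Term n} → IsValue V → zer · V ⟶l zer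
    Ar-add  : {B M N : Term n} → IsBase B → B · (M ⊕ N) ⟶l B · M ⊕ B · N
    Ar-smul : (α : Carrier) {B M : Term n} → IsBase B → B · (α ∙ M) ⟶l α ∙ (B · M)
    Ar-zer  : {B : Term n} → IsBase B → B · zer ⟶l zer
    L-assocl : {M N L : Term n} → M ⊕ (N ⊕ L) ⟶l (M ⊕ N) ⊕ L
    L-assocr : {M N L : Term n} → (M ⊕ N) ⊕ L ⟶l M ⊕ (N ⊕ L)
    L-comm   : {M N : Term n} → M ⊕ N ⟶l N ⊕ M
    L-fact   : (α β : Carrier) {M : Term n} → α ∙ M ⊕ β ∙ M ⟶l (α +ₛ β) ∙ M
    L-fact1  : (α : Carrier) {M : Term n} → α ∙ M ⊕ M ⟶l (α +ₛ 1#) ∙ M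
    L-fact2  : {M : Term n} → M ⊕ M ⟶l (1# +ₛ 1#) ∙ M
    L-mul    : (α β : Carrier) {M : Term n} → α ∙ (β ∙ M) ⟶l (α *ₛ β) ∙ M
    L-dist   : (α : Carrier) {M N : Term n} → α ∙ (M ⊕ N) ⟶l α ∙ M ⊕ α ∙ N
    L-one    : {M : Term n} → 1# ∙ M ⟶l M
    L-zeros  : {M : Term n} → 0# ∙ M ⟶l zer
    L-zerv   : (α : Carrier) → α ∙ zer ⟶l zer {n}
    L-neut   : {M : Term n} → zer ⊕ M ⟶l M
    ξλlin   : {V M M' : Term n} → IsValue V → M ⟶l M' → V · M ⟶l V · M'
    ξappl   : {M M' N : Term n} → M ⟶l M' → M · N ⟶l M' · N
    ξaddl   : {M M' N : Term n} → M ⟶l M' → M ⊕ N ⟶l M' ⊕ N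
    ξaddr   : {M M' N : Term n} → M ⟶l M' → N ⊕ M ⟶l N ⊕ M'
    ξsmul   : (α : Carrier) {M M' : Term n} → M ⟶l M' → α ∙ M ⟶l α ∙ M'

  _⟶lβ_ : {n : ℕ} → Term n → Term n → Set c
  M ⟶lβ M' = (M ⟶l M') ⊎ (M ⟶β M')

  -- CPS grammar.  The reserved variables k, b, b₁, b₂ occur only where
  -- displayed, so they are encoded structurally; only ordinary variables
  -- (bound by λx.S) are tracked in the scope index n.
  data Comp  (n : ℕ) : Set c
  data Susp  (n : ℕ) : Set c
  data SComb (n : ℕ) : Set c
  data Kont  (n : ℕ) : Set c     -- K ::= k | λb.B b K | λb₁.T(λb₂.b₁ b₂ K)
  data CVal  (n : ℕ) : Set c

  data Comp n where
    KB  : Kont n → CVal n → Comp n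
    BBK : CVal n → CVal n → Kont n → Comp n
    TK  : SComb n → Kont n → Comp n

  data Susp n where
    λk : Comp n → Susp n

  data SComb n where
    susp : Susp n → SComb n
    zer  : SComb n
    smul : Carrier → SComb n → SComb n
    add  : SComb n → SComb n → SComb n

  data Kont n where
    k    : Kont n
    λb   : CVal n → Kont n → Kont n
    λb₁  : SComb n → Kont n → Kont n

  data CVal n where
    var : Fin n → CVal n
    lam : Susp (suc n) → CVal n

  data CComb (n : ℕ) : Set c where
    comp : Comp n → CComb n
    zer  : CComb n
    smul : Carrier → CComb n → CComb n
    add  : CComb n → CComb n → CComb n

  ‾C : {n : ℕ} → Comp n → Term n
  σS : {n : ℕ} → Susp n → Term n
  σ  : {n : ℕ} → SComb n → Term n
  ψ  : {n : ℕ} → CVal n → Term n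
  plug : {n : ℕ} → Kont n → Term n → Term n

  ‾C (KB K B)      = plug K (ψ B)
  ‾C (BBK B₁ B₂ K) = plug K (ψ B₁ · ψ B₂)
  ‾C (TK T K)      = plug K (σ T)

  σS (λk C) = ‾C C

  σ (susp S)    = σS S
  σ zer         = zer
  σ (smul α T)  = α ∙ σ T
  σ (add T₁ T₂) = σ T₁ ⊕ σ T₂

  ψ (var i) = var i
  ψ (lam S) = lam (σS S)

  plug k M         = M
  plug (λb B K) M  = plug K (ψ B · M)
  plug (λb₁ T K) M = plug K (M · σ T)

  ‾D : {n : ℕ} → CComb n → Term n
  ‾D (comp C)    = ‾C C
  ‾D zer         = zer
  ‾D (smul α D)  = α ∙ ‾D D
  ‾D (add D₁ D₂) = ‾D D₁ ⊕ ‾D D₂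

module Submission where

-- A continuation K denotes the evaluation context K̲[-]: unfolding the
-- definition of plug, K̲[-] is a stack of frames of two shapes,
--   λb.B b K       contributes the frame  ψ(B) [-]   (argument position),
--   λb₁.T(λb₂…)    contributes the frame  [-] σ(T)   (function position).
-- Both frames are closed under →_{l∪β}: the first by (ξ_{λlin}), since
-- ψ(B) is always a base value, the second by the congruence (ξ).  Each of
-- these rules is present in both →_l and →_{βv}, so it lifts to their
-- union.  The lemma then follows by induction on K, pushing the reduction
-- M → M' through one frame at a time.

open import Defs
open import Level using (Level)
open import Data.Nat using (ℕ)
open import Algebra.Bundles using (Ring)
open import Data.Sum using (inj₁; inj₂)

module Contexts {c ℓ : Level} (R : Ring c ℓ) where
  open Calculus R

  ψ-value : {n : ℕ} (B : CVal n) → IsValue (ψ B)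
  ψ-value (var i) = base (var i)
  ψ-value (lam S) = base (lam (σS S))

  ⟶lβ-argument : {n : ℕ} {V M M' : Term n} →
                 IsValue V → M ⟶lβ M' → V · M ⟶lβ V · M'
  ⟶lβ-argument v (inj₁ r) = inj₁ (ξλlin v r)
  ⟶lβ-argument v (inj₂ r) = inj₂ (ξλlin v r)

  ⟶lβ-function : {n : ℕ} {M M' N : Term n} →
                 M ⟶lβ M' → M · N ⟶lβ M' · N
  ⟶lβ-function (inj₁ r) = inj₁ (ξappl r)
  ⟶lβ-function (inj₂ r) = inj₂ (ξappl r)

  plug-reduces : {n : ℕ} (K : Kont n) {M M' : Term n} →
                 M ⟶lβ M' → plug K M ⟶lβ plug K M'
  plug-reduces k         r = r
  plug-reduces (λb B K)  r = plug-reduces K (⟶lβ-argument (ψ-value B) r)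
  plug-reduces (λb₁ T K) r = plug-reduces K (⟶lβ-function r)

lemma3p11 : {c ℓ : Level} (R : Ring c ℓ) → let open Calculus R in
    {n : ℕ} (K : Kont n) (M M' : Term n) → M ⟶lβ M' → plug K M ⟶lβ plug K M'
lemma3p11 R K M M' = Contexts.plug-reduces R K
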